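{- Let $M\ge 0$, $k\ge 1$, $m\ge 0$ be integers. Let $\mathcal{P}_M(k,m)$ be the set of partitions $\pi=(\lambda_1,\dots,\lambda_M)$ into exactly $M$ parts with smallest part $\lambda_M\ge k$ and $\lambda_i-\lambda_{i+1}\ge m$ for $1\le i\le M-1$ (with $\mathcal{P}_0(k,m)$ consisting only of the empty partition). For $\pi\in\mathcal{P}_M(k,m)$ with $M\ge1$ define \[\omega_{k,m}(\pi):=(\lambda_M+1-k)\prod_{i=1}^{M-1}(\lambda_i-\lambda_{i+1}+1-m),\] and let the weight of the empty partition be $1$. Then \[\sum_{\pi\in\mathcal{P}_M(k,m)}\omega_{k,m}(\pi)\,q^{|\pi|}=\frac{q^{m\binom{M}{2}+kM}}{(q;q)_M^2}.\]
   Context: A partition is a finite weakly decreasing sequence of positive integers; $|\pi|$ is the sum of its parts. $(a;q)_L:=\prod_{n=0}^{L-1}(1-aq^n)$, with $(a;q)_0=1$. -}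

module Defs where

open import Data.Nat using (ℕ; zero; suc; _+_; _*_; _∸_; _≤ᵇ_; _≡ᵇ_)
open import Data.Bool using (Bool; true; false; _∧_; if_then_else_)
open import Data.List using (List; []; _∷_; [_]; map; concatMap; upTo; foldr)
open import Data.Nat.ListAction using (sum)
open import Data.Vec as V using (Vec; []; _∷_)
open import Data.Integer as ℤ using (ℤ; +_)

-- A partition with exactly M parts is written (λ₁, …, λ_M) as a Vec ℕ M,
-- λ₁ first.  inP k m π is true iff π ∈ 𝒫_M(k,m):
--   λ_M ≥ k  and  λ_i - λ_{i+1} ≥ m  (i.e. λ_{i+1} + m ≤ λ_i).
-- (For M = 0, the empty partition is in 𝒫_0(k,m).)
inP : ℕ → ℕ → ∀ {M} → Vec ℕ M → Bool
inP k m [] = true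
inP k m (x ∷ []) = k ≤ᵇ x
inP k m (x ∷ y ∷ r) = (y + m ≤ᵇ x) ∧ inP k m (y ∷ r)

-- ω_{k,m}(π) = (λ_M + 1 - k) ∏_{i=1}^{M-1} (λ_i - λ_{i+1} + 1 - m); weight 1 for empty.
-- (Truncated subtraction is exact on 𝒫_M(k,m), where all factors are ≥ 1.)
ω : ℕ → ℕ → ∀ {M} → Vec ℕ M → ℕ
ω k m [] = 1
ω k m (x ∷ []) = (x + 1) ∸ k
ω k m (x ∷ y ∷ r) = (((x ∸ y) + 1) ∸ m) * ω k m (y ∷ r)

size : ∀ {M} → Vec ℕ M → ℕ
size = V.sum

vecs : (M b : ℕ) → List (Vec ℕ M)
vecs zero b = [ [] ]
vecs (suc M) b = concatMap (λ x → map (x ∷_) (vecs M b)) (upTo (suc b))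

-- coefficient of q^n in  Σ_{π ∈ 𝒫_M(k,m)} ω_{k,m}(π) q^{|π|}
-- (every partition of n has all parts ≤ n, so enumerating vecs M n is exhaustive)
genCoeff : (M k m n : ℕ) → ℕ
genCoeff M k m n =
  sum (map (λ π → if inP k m π ∧ (size π ≡ᵇ n) then ω k m π else 0) (vecs M n))

Series : Set
Series = ℕ → ℤ

_⊛_ : Series → Series → Series
(f ⊛ g) n = foldr ℤ._+_ (+ 0) (map (λ i → f i ℤ.* g (n ∸ i)) (upTo (suc n)))

qPow : ℕ → Series
qPow e n = if n ≡ᵇ e then + 1 else + 0

oneMinusQPow : ℕ → Series
oneMinusQPow j n = qPow 0 n ℤ.- qPow j n

qPoch : ℕ → Series
qPoch zero = qPow 0
qPoch (suc L) = qPoch L ⊛ oneMinusQPow (suc L)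

genSeries : (M k m : ℕ) → Series
genSeries M k m n = + genCoeff M k m n

module Submission where

-- Write G_{M,k}(q) = Σ_{π ∈ 𝒫_M(k,m)} ω_{k,m}(π) q^{|π|}.  Splitting off the
-- smallest part x = λ_M of π, the remaining parts form a partition in
-- 𝒫_{M-1}(x+m,m) and ω_{k,m}(π) = (x+1-k)·ω_{x+m,m}(rest), so
--     G_{M+1,k} = Σ_{x ≥ 0} (x+1-k) q^x G_{M,x+m}.                         (R)
-- Raising the lower bound k by one adds one to each of the M parts, hence
-- G_{M,k+1} = q^M G_{M,k}.  Using this twice, with the tail sum
-- T_k = Σ_{x ≥ k} q^x G_{M,x+m}, one finds
--     G_{M+1,k} = G_{M+1,k+1} + T_k,   T_k = T_{k+1} + q^k G_{M,k+m},
--     G_{M+1,k+1} = q^{M+1} G_{M+1,k},  T_{k+1} = q^{M+1} T_k,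
-- so (1-q^{M+1})² G_{M+1,k} = q^k G_{M,k+m}, and the theorem follows by
-- induction on M.

open import Defs
open import Data.Nat using (ℕ)
import Data.Integer as ℤ

module Shift where

  open import Data.Nat using (ℕ; zero; suc)
  open import Relation.Binary.PropositionalEquality

  -- shift z d g is the sequence of q^d · g, where z is the zero coefficient.
  shift : {A : Set} → A → ℕ → (ℕ → A) → ℕ → A
  shift z zero g n = g n
  shift z (suc d) g zero = z
  shift z (suc d) g (suc n) = shift z d g n

  shift-cong : ∀ {A : Set} {z : A} d {g g' : ℕ → A} → (∀ t → g t ≡ g' t) →
               ∀ n → shift z d g n ≡ shift z d g' n
  shift-cong zero e n = e n
  shift-cong (suc d) e zero = refl
  shift-cong (suc d) e (suc n) = shift-cong d e n

  shift-map : ∀ {A B : Set} (h : A → B) {z : A} {z' : B} → h z ≡ z' →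
              ∀ d g n → shift z' d (λ t → h (g t)) n ≡ h (shift z d g n)
  shift-map h hz zero g n = refl
  shift-map h hz (suc d) g zero = sym hz
  shift-map h hz (suc d) g (suc n) = shift-map h hz d g n

  shift-op : ∀ {A : Set} (_∙_ : A → A → A) {z : A} → z ∙ z ≡ z →
             ∀ d g h n → shift z d (λ t → g t ∙ h t) n ≡ shift z d g n ∙ shift z d h n
  shift-op _∙_ zz zero g h n = refl
  shift-op _∙_ zz (suc d) g h zero = sym zz
  shift-op _∙_ zz (suc d) g h (suc n) = shift-op _∙_ zz d g h n

  shift-suc : ∀ {A : Set} {z : A} d X n → shift z d (shift z 1 X) n ≡ shift z (suc d) X n
  shift-suc zero X n = refl
  shift-suc (suc d) X zero = refl
  shift-suc (suc d) X (suc n) = shift-suc d X n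


-- Weighted sums Σ_x c(x) q^x G_x(q) of a family of ℕ-series, coefficientwise.
module WeightedSum where

  open import Data.Nat
  open import Data.Nat.Properties
  open import Relation.Binary.PropositionalEquality
  open import Data.Nat.Solver using (module +-*-Solver)
  open +-*-Solver
  open Shift

  wsum : (ℕ → ℕ) → (ℕ → ℕ → ℕ) → ℕ → ℕ
  wsum c G zero = c 0 * G 0 0
  wsum c G (suc n) = c 0 * G 0 (suc n) + wsum (λ x → c (suc x)) (λ x → G (suc x)) n

  wsum-cong : ∀ {c c' G G'} → (∀ x → c x ≡ c' x) → (∀ x j → G x j ≡ G' x j) →
              ∀ n → wsum c G n ≡ wsum c' G' n
  wsum-cong ec eG zero = cong₂ _*_ (ec 0) (eG 0 0)
  wsum-cong ec eG (suc n) =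
    cong₂ _+_ (cong₂ _*_ (ec 0) (eG 0 (suc n))) (wsum-cong (λ x → ec (suc x)) (λ x → eG (suc x)) n)

  wsum-+ : ∀ c d G n → wsum (λ x → c x + d x) G n ≡ wsum c G n + wsum d G n
  wsum-+ c d G zero = *-distribʳ-+ (G 0 0) (c 0) (d 0)
  wsum-+ c d G (suc n)
    rewrite wsum-+ (λ x → c (suc x)) (λ x → d (suc x)) (λ x → G (suc x)) n
          | *-distribʳ-+ (G 0 (suc n)) (c 0) (d 0) =
    solve 4 (λ a b x y → a :+ b :+ (x :+ y) := a :+ x :+ (b :+ y)) refl
      (c 0 * G 0 (suc n)) (d 0 * G 0 (suc n))
      (wsum (λ x → c (suc x)) (λ x → G (suc x)) n) (wsum (λ x → d (suc x)) (λ x → G (suc x)) n)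

  wsum-zero : ∀ G n → wsum (λ _ → 0) G n ≡ 0
  wsum-zero G zero = refl
  wsum-zero G (suc n) = wsum-zero (λ x → G (suc x)) n

  wsum-unfold : ∀ c G t → wsum c G t ≡ c 0 * G 0 t + shift 0 1 (wsum (λ x → c (suc x)) (λ x → G (suc x))) t
  wsum-unfold c G zero = sym (+-identityʳ _)
  wsum-unfold c G (suc t) = refl

  wsum-shift : ∀ d c G n → wsum c (λ x → shift 0 d (G x)) n ≡ shift 0 d (wsum c G) n
  wsum-shift zero c G n = refl
  wsum-shift (suc d) c G zero = *-zeroʳ (c 0)
  wsum-shift (suc d) c G (suc n) =
    begin
      c 0 * shift 0 d (G 0) n + wsum c' (λ x → shift 0 (suc d) (G' x)) n
    ≡⟨ cong (c 0 * shift 0 d (G 0) n +_) (wsum-shift (suc d) c' G' n) ⟩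
      c 0 * shift 0 d (G 0) n + shift 0 (suc d) (wsum c' G') n
    ≡⟨ cong₂ _+_ (shift-map (c 0 *_) (*-zeroʳ (c 0)) d (G 0) n) (shift-suc d (wsum c' G') n) ⟨
      shift 0 d (λ t → c 0 * G 0 t) n + shift 0 d (shift 0 1 (wsum c' G')) n
    ≡⟨ shift-op _+_ refl d _ _ n ⟨
      shift 0 d (λ t → c 0 * G 0 t + shift 0 1 (wsum c' G') t) n
    ≡⟨ shift-cong d (wsum-unfold c G) n ⟨
      shift 0 d (wsum c G) n
    ∎
    where open ≡-Reasoning
          c' = λ x → c (suc x)
          G' = λ x → G (suc x)

  wsum-reindex : ∀ d (G : ℕ → ℕ → ℕ) → (∀ x j → G (suc x) j ≡ shift 0 d (G x) j) →
                 ∀ c c' → c' 0 ≡ 0 → (∀ x → c' (suc x) ≡ c x) →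
                 ∀ n → wsum c' G n ≡ shift 0 (suc d) (wsum c G) n
  wsum-reindex d G hG c c' e0 es zero rewrite e0 = refl
  wsum-reindex d G hG c c' e0 es (suc n) rewrite e0 =
    trans (wsum-cong es hG n) (wsum-shift d c G n)

  atLeast : ℕ → ℕ → ℕ
  atLeast zero x = 1
  atLeast (suc k) zero = 0
  atLeast (suc k) (suc x) = atLeast k x

  isEq : ℕ → ℕ → ℕ
  isEq zero zero = 1
  isEq zero (suc x) = 0
  isEq (suc k) zero = 0
  isEq (suc k) (suc x) = isEq k x

  monus-split : ∀ k x → suc x ∸ k ≡ (suc x ∸ suc k) + atLeast k x
  monus-split zero x = +-comm 1 x
  monus-split (suc k) zero = 0∸n≡0 k
  monus-split (suc k) (suc x) = monus-split k x

  atLeast-split : ∀ k x → atLeast k x ≡ atLeast (suc k) x + isEq k x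
  atLeast-split zero zero = refl
  atLeast-split zero (suc x) = refl
  atLeast-split (suc k) zero = refl
  atLeast-split (suc k) (suc x) = atLeast-split k x

  wsum-isEq : ∀ k G n → wsum (isEq k) G n ≡ shift 0 k (G k) n
  wsum-isEq zero G zero = +-identityʳ _
  wsum-isEq zero G (suc n) =
    trans (cong (G 0 (suc n) + 0 +_) (wsum-zero (λ x → G (suc x)) n)) (trans (+-identityʳ _) (+-identityʳ _))
  wsum-isEq (suc k) G zero = refl
  wsum-isEq (suc k) G (suc n) = wsum-isEq k (λ x → G (suc x)) n


module Recurrence (m : ℕ) where

  open import Data.Nat
  open import Data.Nat.Properties
  open import Relation.Binary.PropositionalEquality
  open Shift
  open WeightedSum

  -- W M k n: coefficient of q^n in G_{M,k}.
  W : ℕ → ℕ → ℕ → ℕ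
  W zero k zero = 1
  W zero k (suc n) = 0
  W (suc M) k n = wsum (λ x → suc x ∸ k) (λ x → W M (x + m)) n

  W-shift : ∀ M k n → W M (suc k) n ≡ shift 0 M (W M k) n
  W-shift zero k zero = refl
  W-shift zero k (suc n) = refl
  W-shift (suc M) k n =
    wsum-reindex M (λ x → W M (x + m)) (λ x → W-shift M (x + m))
      (λ x → suc x ∸ k) (λ x → suc x ∸ suc k) (0∸n≡0 k) (λ x → refl) n

  tailSum : ℕ → ℕ → ℕ → ℕ
  tailSum M k = wsum (atLeast k) (λ x → W M (x + m))

  W-peel : ∀ M k n → W (suc M) k n ≡ W (suc M) (suc k) n + tailSum M k n
  W-peel M k n =
    trans (wsum-cong (monus-split k) (λ _ _ → refl) n)
          (wsum-+ (λ x → suc x ∸ suc k) (atLeast k) (λ x → W M (x + m)) n)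

  tailSum-peel : ∀ M k n → tailSum M k n ≡ tailSum M (suc k) n + shift 0 k (W M (k + m)) n
  tailSum-peel M k n =
    trans (wsum-cong (atLeast-split k) (λ _ _ → refl) n)
    (trans (wsum-+ (atLeast (suc k)) (isEq k) F n)
           (cong (tailSum M (suc k) n +_) (wsum-isEq k F n)))
    where F = λ x → W M (x + m)

  tailSum-shift : ∀ M k n → tailSum M (suc k) n ≡ shift 0 (suc M) (tailSum M k) n
  tailSum-shift M k n =
    wsum-reindex M (λ x → W M (x + m)) (λ x → W-shift M (x + m))
      (atLeast k) (atLeast (suc k)) refl (λ _ → refl) n


module Enumeration where

  open import Data.Nat
  open import Data.Nat.Properties
  open import Data.Bool using (true; false; _∧_; if_then_else_; T)
  open import Data.Bool.Properties using (∧-assoc; ∧-zeroʳ; ∧-conicalʳ)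
  open import Data.List using (List; []; _∷_; map; concatMap; upTo; applyUpTo)
  open import Data.List.Properties using (map-++; map-applyUpTo)
  open import Data.Nat.ListAction using (sum)
  open import Data.Nat.ListAction.Properties using (sum-++)
  open import Data.Vec using (Vec; []; _∷_; _∷ʳ_)
  open import Relation.Nullary using (yes; no)
  open import Relation.Binary.PropositionalEquality
  open import Data.Nat.Solver using (module +-*-Solver)
  open +-*-Solver
  open WeightedSum
  open Recurrence

  ΣL : ∀ {A : Set} → List A → (A → ℕ) → ℕ
  ΣL L f = sum (map f L)

  ΣL-concatMap : ∀ {A B : Set} (L : List A) (g : A → List B) f →
                 ΣL (concatMap g L) f ≡ ΣL L (λ x → ΣL (g x) f)
  ΣL-concatMap [] g f = refl
  ΣL-concatMap (x ∷ L) g f =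
    trans (cong sum (map-++ f (g x) (concatMap g L)))
    (trans (sum-++ (map f (g x)) (map f (concatMap g L)))
           (cong (ΣL (g x) f +_) (ΣL-concatMap L g f)))

  ΣL-map : ∀ {A B : Set} (L : List A) (g : A → B) f → ΣL (map g L) f ≡ ΣL L (λ x → f (g x))
  ΣL-map [] g f = refl
  ΣL-map (x ∷ L) g f = cong (f (g x) +_) (ΣL-map L g f)

  ΣL-cong : ∀ {A : Set} (L : List A) {f g : A → ℕ} → (∀ x → f x ≡ g x) → ΣL L f ≡ ΣL L g
  ΣL-cong [] e = refl
  ΣL-cong (x ∷ L) e = cong₂ _+_ (e x) (ΣL-cong L e)

  ΣL-+ : ∀ {A : Set} (L : List A) f g → ΣL L (λ x → f x + g x) ≡ ΣL L f + ΣL L g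
  ΣL-+ [] f g = refl
  ΣL-+ (x ∷ L) f g rewrite ΣL-+ L f g =
    solve 4 (λ a b c d → (a :+ b) :+ (c :+ d) := (a :+ c) :+ (b :+ d)) refl (f x) (g x) (ΣL L f) (ΣL L g)

  ΣL-scale : ∀ {A : Set} (L : List A) c f → ΣL L (λ x → c * f x) ≡ c * ΣL L f
  ΣL-scale [] c f = sym (*-zeroʳ c)
  ΣL-scale (x ∷ L) c f = trans (cong (c * f x +_) (ΣL-scale L c f)) (sym (*-distribˡ-+ c (f x) _))

  ΣL-zero : ∀ {A : Set} (L : List A) f → (∀ x → f x ≡ 0) → ΣL L f ≡ 0
  ΣL-zero [] f e = refl
  ΣL-zero (x ∷ L) f e = cong₂ _+_ (e x) (ΣL-zero L f e)

  ΣL-swap : ∀ {A B : Set} (L : List A) (K : List B) (f : A → B → ℕ) →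
            ΣL L (λ x → ΣL K (f x)) ≡ ΣL K (λ y → ΣL L (λ x → f x y))
  ΣL-swap [] K f = sym (ΣL-zero K _ (λ _ → refl))
  ΣL-swap (x ∷ L) K f =
    trans (cong (ΣL K (f x) +_) (ΣL-swap L K f)) (sym (ΣL-+ K (f x) (λ y → ΣL L (λ x → f x y))))

  vecs-cons : ∀ M b (f : Vec ℕ (suc M) → ℕ) →
              ΣL (vecs (suc M) b) f ≡ ΣL (upTo (suc b)) (λ x → ΣL (vecs M b) (λ v → f (x ∷ v)))
  vecs-cons M b f =
    trans (ΣL-concatMap (upTo (suc b)) (λ x → map (x ∷_) (vecs M b)) f)
          (ΣL-cong (upTo (suc b)) (λ x → ΣL-map (vecs M b) (x ∷_) f))

  vecs-snoc : ∀ M b (f : Vec ℕ (suc M) → ℕ) →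
              ΣL (vecs (suc M) b) f ≡ ΣL (upTo (suc b)) (λ x → ΣL (vecs M b) (λ v → f (v ∷ʳ x)))
  vecs-snoc zero b f = vecs-cons zero b f
  vecs-snoc (suc M) b f =
    begin
      ΣL (vecs (suc (suc M)) b) f
    ≡⟨ vecs-cons (suc M) b f ⟩
      ΣL U (λ y → ΣL (vecs (suc M) b) (λ w → f (y ∷ w)))
    ≡⟨ ΣL-cong U (λ y → vecs-snoc M b (λ w → f (y ∷ w))) ⟩
      ΣL U (λ y → ΣL U (λ x → ΣL (vecs M b) (λ v → f (y ∷ (v ∷ʳ x)))))
    ≡⟨ ΣL-swap U U (λ y x → ΣL (vecs M b) (λ v → f (y ∷ (v ∷ʳ x)))) ⟩
      ΣL U (λ x → ΣL U (λ y → ΣL (vecs M b) (λ v → f ((y ∷ v) ∷ʳ x))))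
    ≡⟨ ΣL-cong U (λ x → vecs-cons M b (λ u → f (u ∷ʳ x))) ⟨
      ΣL U (λ x → ΣL (vecs (suc M) b) (λ u → f (u ∷ʳ x)))
    ∎
    where open ≡-Reasoning
          U = upTo (suc b)

  sumBelow : ℕ → (ℕ → ℕ) → ℕ
  sumBelow L u = sum (applyUpTo u L)

  ΣL-upTo : ∀ L u → ΣL (upTo L) u ≡ sumBelow L u
  ΣL-upTo L u = cong sum (map-applyUpTo (λ i → i) u L)

  sumBelow-cong : ∀ L {u u'} → (∀ x → x < L → u x ≡ u' x) → sumBelow L u ≡ sumBelow L u'
  sumBelow-cong zero e = refl
  sumBelow-cong (suc L) e = cong₂ _+_ (e 0 (s≤s z≤n)) (sumBelow-cong L (λ x x<L → e (suc x) (s≤s x<L)))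

  sumBelow-trunc : ∀ L L' u → (∀ x → L ≤ x → u x ≡ 0) → L ≤ L' → sumBelow L' u ≡ sumBelow L u
  sumBelow-trunc zero zero u e _ = refl
  sumBelow-trunc zero (suc L') u e _ = cong₂ _+_ (e 0 z≤n) (sumBelow-trunc zero L' (λ i → u (suc i)) (λ x _ → e (suc x) z≤n) z≤n)
  sumBelow-trunc (suc L) (suc L') u e (s≤s le) =
    cong (u 0 +_) (sumBelow-trunc L L' (λ i → u (suc i)) (λ x le' → e (suc x) (s≤s le')) le)

  sumBelow-wsum : ∀ c G n → sumBelow (suc n) (λ x → c x * G x (n ∸ x)) ≡ wsum c G n
  sumBelow-wsum c G zero = +-identityʳ _
  sumBelow-wsum c G (suc n) = cong (c 0 * G 0 (suc n) +_) (sumBelow-wsum (λ x → c (suc x)) (λ x → G (suc x)) n)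

  ≡ᵇ-shift : ∀ s x n → x ≤ n → (x + s ≡ᵇ n) ≡ (s ≡ᵇ n ∸ x)
  ≡ᵇ-shift s zero n _ = refl
  ≡ᵇ-shift s (suc x) (suc n) (s≤s le) = ≡ᵇ-shift s x n le

  ≡ᵇ-big : ∀ s x n → n < x → (x + s ≡ᵇ n) ≡ false
  ≡ᵇ-big s (suc x) zero _ = refl
  ≡ᵇ-big s (suc x) (suc n) (s≤s lt) = ≡ᵇ-big s x n lt

  size-snoc : ∀ {M} (v : Vec ℕ M) x → size (v ∷ʳ x) ≡ x + size v
  size-snoc [] x = refl
  size-snoc (y ∷ v) x rewrite size-snoc v x =
    solve 3 (λ a b c → a :+ (b :+ c) := b :+ (a :+ c)) refl y x (size v)

  monus-vanish : ∀ k x → (k ≤ᵇ x) ≡ false → suc x ∸ k ≡ 0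
  monus-vanish k x e = m≤n⇒m∸n≡0 {suc x} {k} (≰⇒> {k} {x} (λ k≤x → subst T e (≤⇒≤ᵇ {k} {x} k≤x)))

  module _ (m : ℕ) where

    term : ∀ {M} → ℕ → ℕ → Vec ℕ M → ℕ
    term k n π = if inP k m π ∧ (size π ≡ᵇ n) then ω k m π else 0

    inP-snoc : ∀ k {M} (v : Vec ℕ M) x → inP k m (v ∷ʳ x) ≡ inP (x + m) m v ∧ (k ≤ᵇ x)
    inP-snoc k [] x = refl
    inP-snoc k (y ∷ []) x = refl
    inP-snoc k (y ∷ z ∷ r) x rewrite inP-snoc k (z ∷ r) x =
      sym (∧-assoc (z + m ≤ᵇ y) (inP (x + m) m (z ∷ r)) (k ≤ᵇ x))

    ω-snoc : ∀ k {M} (v : Vec ℕ M) x → inP (x + m) m v ≡ true →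
             ω k m (v ∷ʳ x) ≡ ω (x + m) m v * ((x + 1) ∸ k)
    ω-snoc k [] x e = sym (+-identityʳ _)
    ω-snoc k (y ∷ []) x e = cong (_* ((x + 1) ∸ k)) gap
      where
      x+m≤y : x + m ≤ y
      x+m≤y = ≤ᵇ⇒≤ (x + m) y (subst T (sym e) _)
      gap : (y ∸ x) + 1 ∸ m ≡ (y + 1) ∸ (x + m)
      gap = trans (cong (_∸ m) (sym (+-∸-comm 1 (≤-trans (m≤m+n x m) x+m≤y)))) (∸-+-assoc (y + 1) x m)
    ω-snoc k (y ∷ z ∷ r) x e rewrite ω-snoc k (z ∷ r) x (∧-conicalʳ (z + m ≤ᵇ y) _ e) =
      sym (*-assoc ((y ∸ z) + 1 ∸ m) (ω (x + m) m (z ∷ r)) ((x + 1) ∸ k))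

    term-snoc : ∀ k n {M} (v : Vec ℕ M) x → x ≤ n →
                term k n (v ∷ʳ x) ≡ (suc x ∸ k) * term (x + m) (n ∸ x) v
    term-snoc k n v x x≤n
      rewrite inP-snoc k v x | size-snoc v x | ≡ᵇ-shift (size v) x n x≤n
      with inP (x + m) m v in eP | k ≤ᵇ x in eK
    ... | false | _ = sym (*-zeroʳ (suc x ∸ k))
    ... | true | false =
      sym (cong (_* (if true ∧ (size v ≡ᵇ n ∸ x) then ω (x + m) m v else 0)) (monus-vanish k x eK))
    ... | true | true with size v ≡ᵇ n ∸ x
    ...   | false = sym (*-zeroʳ (suc x ∸ k))
    ...   | true =
      trans (ω-snoc k v x eP)
      (trans (*-comm (ω (x + m) m v) ((x + 1) ∸ k)) (cong (λ z → (z ∸ k) * ω (x + m) m v) (+-comm x 1)))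

    term-size : ∀ {M} j n (v : Vec ℕ M) → (size v ≡ᵇ n) ≡ false → term j n v ≡ 0
    term-size j n v e rewrite e | ∧-zeroʳ (inP j m v) = refl

  vecs-bound : ∀ M n (f : Vec ℕ M → ℕ) → (∀ v → (size v ≡ᵇ n) ≡ false → f v ≡ 0) →
               ∀ b → n ≤ b → ΣL (vecs M b) f ≡ ΣL (vecs M n) f
  vecs-bound zero n f hf b le = refl
  vecs-bound (suc M) n f hf b le =
    begin
      ΣL (vecs (suc M) b) f
    ≡⟨ trans (vecs-cons M b f) (ΣL-upTo (suc b) (slice b)) ⟩
      sumBelow (suc b) (slice b)
    ≡⟨ sumBelow-cong (suc b) (λ x _ → slice-bound x) ⟩
      sumBelow (suc b) (slice n)
    ≡⟨ sumBelow-trunc (suc n) (suc b) (slice n) (λ x → slice-big n x) (s≤s le) ⟩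
      sumBelow (suc n) (slice n)
    ≡⟨ trans (vecs-cons M n f) (ΣL-upTo (suc n) (slice n)) ⟨
      ΣL (vecs (suc M) n) f
    ∎
    where
    open ≡-Reasoning
    slice : ℕ → ℕ → ℕ
    slice b' x = ΣL (vecs M b') (λ v → f (x ∷ v))
    slice-big : ∀ b' x → suc n ≤ x → slice b' x ≡ 0
    slice-big b' x lt = ΣL-zero (vecs M b') _ (λ v → hf (x ∷ v) (≡ᵇ-big (size v) x n lt))
    slice-bound : ∀ x → slice b x ≡ slice n x
    slice-bound x with x ≤? n
    ... | yes x≤n =
      trans (vecs-bound M (n ∸ x) (λ v → f (x ∷ v)) hg b (≤-trans (m∸n≤m n x) le))
            (sym (vecs-bound M (n ∸ x) (λ v → f (x ∷ v)) hg n (m∸n≤m n x)))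
      where hg : ∀ v → (size v ≡ᵇ n ∸ x) ≡ false → f (x ∷ v) ≡ 0
            hg v e = hf (x ∷ v) (trans (≡ᵇ-shift (size v) x n x≤n) e)
    ... | no x≰n = trans (slice-big b x (≰⇒> x≰n)) (sym (slice-big n x (≰⇒> x≰n)))

  genCoeff≡W : ∀ m M k n → genCoeff M k m n ≡ W m M k n
  genCoeff≡W m zero k zero = refl
  genCoeff≡W m zero k (suc n) = refl
  genCoeff≡W m (suc M) k n =
    begin
      ΣL (vecs (suc M) n) (term m k n)
    ≡⟨ trans (vecs-snoc M n (term m k n)) (ΣL-upTo (suc n) _) ⟩
      sumBelow (suc n) (λ x → ΣL (vecs M n) (λ v → term m k n (v ∷ʳ x)))
    ≡⟨ sumBelow-cong (suc n) lastPart ⟩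
      sumBelow (suc n) (λ x → (suc x ∸ k) * W m M (x + m) (n ∸ x))
    ≡⟨ sumBelow-wsum (λ x → suc x ∸ k) (λ x → W m M (x + m)) n ⟩
      W m (suc M) k n
    ∎
    where
    open ≡-Reasoning
    lastPart : ∀ x → x < suc n → ΣL (vecs M n) (λ v → term m k n (v ∷ʳ x)) ≡ (suc x ∸ k) * W m M (x + m) (n ∸ x)
    lastPart x (s≤s x≤n) =
      trans (ΣL-cong (vecs M n) (λ v → term-snoc m k n v x x≤n))
      (trans (ΣL-scale (vecs M n) (suc x ∸ k) (term m (x + m) (n ∸ x)))
      (cong ((suc x ∸ k) *_)
        (trans (vecs-bound M (n ∸ x) (term m (x + m) (n ∸ x)) (term-size m (x + m) (n ∸ x)) n (m∸n≤m n x))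
               (genCoeff≡W m M (x + m) (n ∸ x)))))


module PowerSeries where

  open import Data.Nat as N using (ℕ; zero; suc; _∸_)
  open import Data.Integer using (+_; _+_; _*_; _-_)
  open import Data.Integer.Properties
  open import Data.List using (foldr; applyUpTo)
  open import Data.List.Properties using (map-applyUpTo)
  open import Relation.Binary.PropositionalEquality
  open import Data.Integer.Solver using (module +-*-Solver)
  open +-*-Solver
  open Shift

  infix 4 _≐_
  _≐_ : Series → Series → Set
  f ≐ g = ∀ n → f n ≡ g n

  infixl 7 _⋆_
  _⋆_ : Series → Series → Series
  (f ⋆ g) zero = f 0 * g 0
  (f ⋆ g) (suc n) = f 0 * g (suc n) + ((λ i → f (suc i)) ⋆ g) n

  ⊛≐⋆ : ∀ f g → f ⊛ g ≐ f ⋆ g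
  ⊛≐⋆ f g n = trans (cong (foldr _+_ (+ 0)) (map-applyUpTo (λ i → i) (λ i → f i * g (n ∸ i)) (suc n))) (sum≡⋆ f n)
    where
    sum≡⋆ : ∀ f n → foldr _+_ (+ 0) (applyUpTo (λ i → f i * g (n ∸ i)) (suc n)) ≡ (f ⋆ g) n
    sum≡⋆ f zero = +-identityʳ _
    sum≡⋆ f (suc n) = cong (λ z → f 0 * g (suc n) + z) (sum≡⋆ (λ i → f (suc i)) n)

  ⋆-cong : ∀ {f f' g g'} → f ≐ f' → g ≐ g' → f ⋆ g ≐ f' ⋆ g'
  ⋆-cong ef eg zero = cong₂ _*_ (ef 0) (eg 0)
  ⋆-cong ef eg (suc n) = cong₂ _+_ (cong₂ _*_ (ef 0) (eg (suc n))) (⋆-cong (λ i → ef (suc i)) eg n)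

  ⋆-congʳ : ∀ f {g g'} → g ≐ g' → f ⋆ g ≐ f ⋆ g'
  ⋆-congʳ f = ⋆-cong (λ _ → refl)

  ⋆-distrib-+ : ∀ f h g n → ((λ i → f i + h i) ⋆ g) n ≡ (f ⋆ g) n + (h ⋆ g) n
  ⋆-distrib-+ f h g zero = *-distribʳ-+ (g 0) (f 0) (h 0)
  ⋆-distrib-+ f h g (suc n) rewrite ⋆-distrib-+ (λ i → f (suc i)) (λ i → h (suc i)) g n =
    solve 5 (λ a b c x y → (a :+ b) :* c :+ (x :+ y) := (a :* c :+ x) :+ (b :* c :+ y)) refl
      (f 0) (h 0) (g (suc n)) (((λ i → f (suc i)) ⋆ g) n) (((λ i → h (suc i)) ⋆ g) n)

  ⋆-distrib-- : ∀ f h g n → ((λ i → f i - h i) ⋆ g) n ≡ (f ⋆ g) n - (h ⋆ g) n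
  ⋆-distrib-- f h g zero = solve 3 (λ a b c → (a :- b) :* c := a :* c :- b :* c) refl (f 0) (h 0) (g 0)
  ⋆-distrib-- f h g (suc n) rewrite ⋆-distrib-- (λ i → f (suc i)) (λ i → h (suc i)) g n =
    solve 5 (λ a b c x y → (a :- b) :* c :+ (x :- y) := (a :* c :+ x) :- (b :* c :+ y)) refl
      (f 0) (h 0) (g (suc n)) (((λ i → f (suc i)) ⋆ g) n) (((λ i → h (suc i)) ⋆ g) n)

  ⋆-scale : ∀ a f g n → ((λ i → a * f i) ⋆ g) n ≡ a * (f ⋆ g) n
  ⋆-scale a f g zero = *-assoc a (f 0) (g 0)
  ⋆-scale a f g (suc n) rewrite ⋆-scale a (λ i → f (suc i)) g n =
    solve 4 (λ a b c x → a :* b :* c :+ a :* x := a :* (b :* c :+ x)) refl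
      a (f 0) (g (suc n)) (((λ i → f (suc i)) ⋆ g) n)

  ⋆-last : ∀ f g n → (f ⋆ g) (suc n) ≡ (f ⋆ (λ i → g (suc i))) n + f (suc n) * g 0
  ⋆-last f g zero = refl
  ⋆-last f g (suc n) rewrite ⋆-last (λ i → f (suc i)) g n =
    sym (+-assoc (f 0 * g (suc (suc n))) (((λ i → f (suc i)) ⋆ (λ i → g (suc i))) n) (f (suc (suc n)) * g 0))

  ⋆-comm : ∀ f g → f ⋆ g ≐ g ⋆ f
  ⋆-comm f g zero = *-comm (f 0) (g 0)
  ⋆-comm f g (suc n) rewrite ⋆-comm (λ i → f (suc i)) g n | ⋆-last g f n =
    trans (+-comm (f 0 * g (suc n)) ((g ⋆ (λ i → f (suc i))) n))
          (cong (λ z → (g ⋆ (λ i → f (suc i))) n + z) (*-comm (f 0) (g (suc n))))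

  ⋆-assoc : ∀ f g h → (f ⋆ g) ⋆ h ≐ f ⋆ (g ⋆ h)
  ⋆-assoc f g h zero = *-assoc (f 0) (g 0) (h 0)
  ⋆-assoc f g h (suc n) =
    begin
      f 0 * g 0 * h (suc n) + ((λ t → f 0 * g' t + (f' ⋆ g) t) ⋆ h) n
    ≡⟨ cong (λ z → f 0 * g 0 * h (suc n) + z)
         (trans (⋆-distrib-+ (λ t → f 0 * g' t) (f' ⋆ g) h n) (cong₂ _+_ (⋆-scale (f 0) g' h n) (⋆-assoc f' g h n))) ⟩
      f 0 * g 0 * h (suc n) + (f 0 * (g' ⋆ h) n + (f' ⋆ (g ⋆ h)) n)
    ≡⟨ solve 5 (λ a b c x y → a :* b :* c :+ (a :* x :+ y) := a :* (b :* c :+ x) :+ y) refl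
         (f 0) (g 0) (h (suc n)) ((g' ⋆ h) n) ((f' ⋆ (g ⋆ h)) n) ⟩
      f 0 * (g 0 * h (suc n) + (g' ⋆ h) n) + (f' ⋆ (g ⋆ h)) n
    ∎
    where open ≡-Reasoning
          f' = λ i → f (suc i)
          g' = λ i → g (suc i)

  ⋆-swap : ∀ P Q X → P ⋆ (Q ⋆ X) ≐ Q ⋆ (P ⋆ X)
  ⋆-swap P Q X n = trans (sym (⋆-assoc P Q X n)) (trans (⋆-cong (⋆-comm P Q) (λ _ → refl) n) (⋆-assoc Q P X n))

  ⋆-square : ∀ P o X → ((P ⋆ o) ⋆ (P ⋆ o)) ⋆ X ≐ (P ⋆ P) ⋆ (o ⋆ (o ⋆ X))
  ⋆-square P o X n =
    begin
      ((P ⋆ o) ⋆ (P ⋆ o) ⋆ X) n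
    ≡⟨ ⋆-assoc (P ⋆ o) (P ⋆ o) X n ⟩
      ((P ⋆ o) ⋆ ((P ⋆ o) ⋆ X)) n
    ≡⟨ ⋆-congʳ (P ⋆ o) (⋆-assoc P o X) n ⟩
      ((P ⋆ o) ⋆ (P ⋆ (o ⋆ X))) n
    ≡⟨ ⋆-assoc P o (P ⋆ (o ⋆ X)) n ⟩
      (P ⋆ (o ⋆ (P ⋆ (o ⋆ X)))) n
    ≡⟨ ⋆-congʳ P (⋆-swap o P (o ⋆ X)) n ⟩
      (P ⋆ (P ⋆ (o ⋆ (o ⋆ X)))) n
    ≡⟨ ⋆-assoc P P (o ⋆ (o ⋆ X)) n ⟨
      ((P ⋆ P) ⋆ (o ⋆ (o ⋆ X))) n
    ∎
    where open ≡-Reasoning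

  ⋆-zero : ∀ g n → ((λ _ → + 0) ⋆ g) n ≡ + 0
  ⋆-zero g zero = refl
  ⋆-zero g (suc n) = trans (+-identityˡ _) (⋆-zero g n)

  qPow-⋆ : ∀ d g → qPow d ⋆ g ≐ shift (+ 0) d g
  qPow-⋆ zero g zero = *-identityˡ (g 0)
  qPow-⋆ zero g (suc n) rewrite ⋆-zero g n = trans (+-identityʳ _) (*-identityˡ (g (suc n)))
  qPow-⋆ (suc d) g zero = refl
  qPow-⋆ (suc d) g (suc n) = trans (+-identityˡ _) (qPow-⋆ d g n)

  shift-qPow : ∀ d e → shift (+ 0) d (qPow e) ≐ qPow (d N.+ e)
  shift-qPow zero e n = refl
  shift-qPow (suc d) e zero = refl
  shift-qPow (suc d) e (suc n) = shift-qPow d e n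

  qPoch-suc : ∀ L → qPoch (suc L) ≐ qPoch L ⋆ oneMinusQPow (suc L)
  qPoch-suc L = ⊛≐⋆ (qPoch L) (oneMinusQPow (suc L))

  ↑ : (ℕ → ℕ) → Series
  ↑ X t = + X t

  telescope : ∀ N (X X' Y : ℕ → ℕ) → (∀ n → X n ≡ X' n N.+ Y n) → (∀ n → X' n ≡ shift 0 N X n) →
              oneMinusQPow N ⋆ ↑ X ≐ ↑ Y
  telescope N X X' Y split shifted n =
    begin
      ((λ i → qPow 0 i - qPow N i) ⋆ ↑ X) n
    ≡⟨ ⋆-distrib-- (qPow 0) (qPow N) (↑ X) n ⟩
      (qPow 0 ⋆ ↑ X) n - (qPow N ⋆ ↑ X) n
    ≡⟨ cong₂ _-_ (qPow-⋆ 0 (↑ X) n)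
         (trans (qPow-⋆ N (↑ X) n) (trans (shift-map +_ refl N X n) (cong +_ (sym (shifted n))))) ⟩
      + X n - + X' n
    ≡⟨ cong (λ z → + z - + X' n) (split n) ⟩
      + (X' n N.+ Y n) - + X' n
    ≡⟨ cong (_- + X' n) (pos-+ (X' n) (Y n)) ⟩
      (+ X' n + + Y n) - + X' n
    ≡⟨ solve 2 (λ a b → (a :+ b) :- a := b) refl (+ X' n) (+ Y n) ⟩
      + Y n
    ∎
    where open ≡-Reasoning


module GeneratingFunction (m : ℕ) where

  open import Data.Nat as N using (ℕ; zero; suc)
  open import Data.Nat.Properties using (*-zeroʳ)
  open import Data.Nat.Combinatorics using (_C_; nC1≡n; nCk+nC[k+1]≡[n+1]C[k+1])
  open import Relation.Binary.PropositionalEquality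
  open import Data.Nat.Solver using (module +-*-Solver)
  open +-*-Solver
  open Shift
  open Recurrence m
  open PowerSeries

  E : ℕ → ℕ → ℕ
  E M k = m N.* (M C 2) N.+ k N.* M

  E-zero : ∀ k → E 0 k ≡ 0
  E-zero k = cong₂ N._+_ (*-zeroʳ m) (*-zeroʳ k)

  -- C(M+1,2) = C(M,2) + M, so q^k · q^{E(M,k+m)} = q^{E(M+1,k)}.
  E-suc : ∀ M k → k N.+ E M (k N.+ m) ≡ E (suc M) k
  E-suc M k rewrite sym (nCk+nC[k+1]≡[n+1]C[k+1] M 1) | nC1≡n M =
    solve 4 (λ k m c M → k :+ (m :* c :+ (k :+ m) :* M) := m :* (M :+ c) :+ k :* (con 1 :+ M)) refl k m (M C 2) M

  two-step : ∀ M k → oneMinusQPow (suc M) ⋆ (oneMinusQPow (suc M) ⋆ ↑ (W (suc M) k))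
                     ≐ qPow k ⋆ ↑ (W M (k N.+ m))
  two-step M k n =
    begin
      (o ⋆ (o ⋆ ↑ (W (suc M) k))) n
    ≡⟨ ⋆-congʳ o (telescope (suc M) (W (suc M) k) (W (suc M) (suc k)) (tailSum M k)
                    (W-peel M k) (W-shift (suc M) k)) n ⟩
      (o ⋆ ↑ (tailSum M k)) n
    ≡⟨ telescope (suc M) (tailSum M k) (tailSum M (suc k)) (shift 0 k (W M (k N.+ m)))
         (tailSum-peel M k) (tailSum-shift M k) n ⟩
      ℤ.+ shift 0 k (W M (k N.+ m)) n
    ≡⟨ shift-map ℤ.+_ refl k (W M (k N.+ m)) n ⟨
      shift (ℤ.+ 0) k (↑ (W M (k N.+ m))) n
    ≡⟨ qPow-⋆ k (↑ (W M (k N.+ m))) n ⟨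
      (qPow k ⋆ ↑ (W M (k N.+ m))) n
    ∎
    where open ≡-Reasoning
          o = oneMinusQPow (suc M)

  generating-function : ∀ M k → (qPoch M ⋆ qPoch M) ⋆ ↑ (W M k) ≐ qPow (E M k)
  generating-function zero k n rewrite E-zero k =
    trans (⋆-cong (qPow-⋆ 0 (qPow 0)) (λ _ → refl) n) (trans (qPow-⋆ 0 (↑ (W 0 k)) n) (W-zero n))
    where W-zero : ↑ (W 0 k) ≐ qPow 0
          W-zero zero = refl
          W-zero (suc n) = refl
  generating-function (suc M) k n =
    begin
      ((Q' ⋆ Q') ⋆ ↑ (W (suc M) k)) n
    ≡⟨ ⋆-cong (⋆-cong (qPoch-suc M) (qPoch-suc M)) (λ _ → refl) n ⟩
      (((Q ⋆ o) ⋆ (Q ⋆ o)) ⋆ ↑ (W (suc M) k)) n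
    ≡⟨ ⋆-square Q o (↑ (W (suc M) k)) n ⟩
      ((Q ⋆ Q) ⋆ (o ⋆ (o ⋆ ↑ (W (suc M) k)))) n
    ≡⟨ ⋆-congʳ (Q ⋆ Q) (two-step M k) n ⟩
      ((Q ⋆ Q) ⋆ (qPow k ⋆ ↑ (W M (k N.+ m)))) n
    ≡⟨ ⋆-swap (Q ⋆ Q) (qPow k) (↑ (W M (k N.+ m))) n ⟩
      (qPow k ⋆ ((Q ⋆ Q) ⋆ ↑ (W M (k N.+ m)))) n
    ≡⟨ ⋆-congʳ (qPow k) (generating-function M (k N.+ m)) n ⟩
      (qPow k ⋆ qPow (E M (k N.+ m))) n
    ≡⟨ trans (qPow-⋆ k _ n) (shift-qPow k _ n) ⟩
      qPow (k N.+ E M (k N.+ m)) n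
    ≡⟨ cong (λ e → qPow e n) (E-suc M k) ⟩
      qPow (E (suc M) k) n
    ∎
    where open ≡-Reasoning
          Q = qPoch M
          Q' = qPoch (suc M)
          o = oneMinusQPow (suc M)


open import Data.Nat using (_+_; _*_; _≤_)
open import Data.Nat.Combinatorics using (_C_)
open import Relation.Binary.PropositionalEquality using (_≡_; trans; cong)
open PowerSeries using (⊛≐⋆; ⋆-cong)
open Enumeration using (genCoeff≡W)
open GeneratingFunction using (generating-function)

theorem5 : (M k m : ℕ) → 1 ≤ k → (n : ℕ) →
    ((qPoch M ⊛ qPoch M) ⊛ genSeries M k m) n ≡ qPow (m * (M C 2) + k * M) n
theorem5 M k m _ n =
  trans (⊛≐⋆ (qPoch M ⊛ qPoch M) (genSeries M k m) n)
  (trans (⋆-cong (⊛≐⋆ (qPoch M) (qPoch M)) (λ t → cong ℤ.+_ (genCoeff≡W m M k t)) n)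
         (generating-function m M k n))
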